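{- There exists an infinite $\frac53^+$-free Dean word that is $12$-directed.
   Context: Words are over $\Sigma_4=\{0,1,2,3\}$; a word is reduced if it has no factor in $\{02,20,13,31\}$; a Dean word is a (finite or infinite) reduced word with no factor $uu$, $u$ nonempty. The exponent of a nonempty finite word is its length divided by its least period; a word is $\alpha^+$-free if it has no factor of exponent $>\alpha$. A word $u$ is $d$-directed if for every factor $f$ of $u$ of length $d$, the reversal $f^R$ of $f$ is not a factor of $u$. -}

module Defs where

open import Data.Nat using (ℕ; zero; suc; _+_; _*_; _∸_; _≤_; _<_)
open import Data.Fin using (Fin)
open import Data.Product using (Σ; _×_; ∃)
open import Relation.Binary.PropositionalEquality using (_≡_)
open import Relation.Nullary using (¬_)

InfWord : Set
InfWord = ℕ → Fin 4

Forbidden : Fin 4 → Fin 4 → Set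
Forbidden a b = ((Data.Fin.toℕ a ≡ 0) × (Data.Fin.toℕ b ≡ 2))
  Data.Sum.⊎ (((Data.Fin.toℕ a ≡ 2) × (Data.Fin.toℕ b ≡ 0))
  Data.Sum.⊎ (((Data.Fin.toℕ a ≡ 1) × (Data.Fin.toℕ b ≡ 3))
  Data.Sum.⊎ ((Data.Fin.toℕ a ≡ 3) × (Data.Fin.toℕ b ≡ 1))))
  where import Data.Sum

Reduced : InfWord → Set
Reduced w = ∀ i → ¬ Forbidden (w i) (w (suc i))

SquareAt : InfWord → ℕ → ℕ → Set
SquareAt w i n = ∀ k → k < n → w (i + k) ≡ w (i + n + k)

SquareFree : InfWord → Set
SquareFree w = ∀ i n → 1 ≤ n → ¬ SquareAt w i n

Dean : InfWord → Set
Dean w = Reduced w × SquareFree w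

HasPeriod : InfWord → ℕ → ℕ → ℕ → Set
HasPeriod w i L p = ∀ k → k + p < L → w (i + k) ≡ w (i + k + p)

IsLeastPeriod : InfWord → ℕ → ℕ → ℕ → Set
IsLeastPeriod w i L p =
  1 ≤ p × HasPeriod w i L p × (∀ q → 1 ≤ q → q < p → ¬ HasPeriod w i L q)

-- Exponent of the nonempty factor w[i .. i+L) is L / p with p its least
-- period; the exponent exceeds 5/3 iff 3·L > 5·p.
-- α⁺-free for α = 5/3: no factor has exponent > 5/3.
FiveThirdsPlusFree : InfWord → Set
FiveThirdsPlusFree w =
  ∀ i L p → 1 ≤ L → IsLeastPeriod w i L p → ¬ (5 * p < 3 * L)

ReversalAt : InfWord → ℕ → ℕ → ℕ → Set
ReversalAt w d i j = ∀ k → k < d → w (j + k) ≡ w (i + (d ∸ 1 ∸ k))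

Directed : ℕ → InfWord → Set
Directed d w = ∀ i → ¬ (∃ λ j → ReversalAt w d i j)

module Submission where

-- The word is the fixed point w = h^ω(0) of the 4-uniform morphism
-- h : 0 ↦ 0123, 1 ↦ 0321, 2 ↦ 2301, 3 ↦ 2103.  The r-th letter of every
-- block h(a) has the parity of r, so w n has the parity of n: hence w is
-- reduced and has no repetition of odd period.  By strong induction on the
-- period p, every factor of w with period p has length at most 5p/3.  For
-- p ≡ 2 (mod 4) this is a finite check: factors of length 5 whose positions
-- differ by 2 modulo 4 never coincide, and no factor of length 4 is a square.
-- For p = 4s the repetition is the image under h of a repetition of period s,
-- because two consecutive letters of a block h(a), or one letter of it
-- together with the parity of a, determine a.  Directedness is a finite check
-- on the factors of length 12, each of which occurs in h²(ab) for a factor ab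
-- of w.

open import Defs
open import Data.Product using (Σ; _×_; _,_)

open import Data.Empty using (⊥-elim)
open import Data.Sum using (inj₁; inj₂)
open import Data.Fin as Fin using (Fin; toℕ; inject₁)
open import Data.Fin.Properties
  using (all?; toℕ<n; toℕ≤pred[n]; toℕ-injective; toℕ-fromℕ<) renaming (_≟_ to _≟ᶠ_)
open import Data.List using (List; []; _∷_; _++_; [_]; take; drop; reverse; concatMap)
open import Data.List.Properties using (≡-dec; reverse-++)
open import Data.Nat
  using (ℕ; zero; suc; _+_; _*_; _∸_; _≤_; _<_; z≤n; s≤s; _≤?_; parity)
open import Data.Nat.DivMod
  using (_/_; _%_; _mod_; _divMod_; result; +-distrib-/-∣ʳ; m<n⇒m/n≡0; m*n/n≡m; m/n<m;
         [m+kn]%n≡m%n; m<n⇒m%n≡m)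
open import Data.Nat.Divisibility using (n∣m*n)
open import Data.Nat.Induction using (<-wellFounded; <-rec)
open import Data.Nat.Properties
  using (+-identityʳ; +-comm; +-assoc; +-suc; *-assoc; *-distribˡ-+; *-distribʳ-+;
         ≤-refl; ≤-reflexive; ≤-trans; n≤1+n; m≤m+n; m≤n+m; m<n+m; 0<1+n; m<m*n; n≮0;
         +-monoˡ-≤; +-monoˡ-<; *-monoˡ-≤; *-monoʳ-≤; +-cancelˡ-≤;
         <⇒≤; <⇒≱; ≤⇒≯; ≰⇒>; m∸n+n≡m; m+[n∸m]≡n; ∸-+-assoc; module ≤-Reasoning)
open import Data.Nat.Tactic.RingSolver using (solve-∀)
open import Data.Parity using (Parity; 0ℙ; 1ℙ; _⁻¹) renaming (_≟_ to _≟ᵖ_)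
import Data.Parity.Base as ℙ
import Data.Parity.Properties as ℙ
open import Data.Vec using (Vec; []; _∷_; lookup; toList; tabulate)
open import Data.Vec.Properties using (tabulate∘lookup; tabulate-cong)
open import Induction.WellFounded using (WfRec; module FixPoint)
open import Relation.Binary.PropositionalEquality
  using (_≡_; _≢_; refl; sym; trans; cong; cong₂; subst; module ≡-Reasoning)
open import Relation.Nullary using (Dec; yes; no)
open import Relation.Nullary.Decidable using (from-yes; _→-dec_; ¬?)

pattern 0F = Fin.zero
pattern 1F = Fin.suc 0F
pattern 2F = Fin.suc 1F
pattern 3F = Fin.suc 2F

h : Fin 4 → Vec (Fin 4) 4
h 0F = 0F ∷ 1F ∷ 2F ∷ 3F ∷ []
h 1F = 0F ∷ 3F ∷ 2F ∷ 1F ∷ []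
h 2F = 2F ∷ 3F ∷ 0F ∷ 1F ∷ []
h 3F = 2F ∷ 1F ∷ 0F ∷ 3F ∷ []

hWord : List (Fin 4) → List (Fin 4)
hWord = concatMap (λ a → toList (h a))

slice : ℕ → ℕ → List (Fin 4) → List (Fin 4)
slice k L v = take L (drop k v)

letterParity : Fin 4 → Parity
letterParity a = parity (toℕ a)

Alternating : Fin 4 → Fin 4 → Set
Alternating a b = letterParity b ≡ letterParity a ⁻¹

alternating? : ∀ a b → Dec (Alternating a b)
alternating? a b = letterParity b ≟ᵖ letterParity a ⁻¹

h²Slice : Fin 4 → Fin 4 → Fin 4 → Fin 4 → List (Fin 4)
h²Slice a b r₁ r₂ = slice (toℕ r₂) 12 (hWord (slice (toℕ r₁) 4 (hWord (a ∷ b ∷ []))))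

h-parity : ∀ a r → letterParity (lookup (h a) r) ≡ letterParity r
h-parity = from-yes (all? λ a → all? λ r → letterParity (lookup (h a) r) ≟ᵖ letterParity r)

h-injective-with-parity : ∀ a b r → lookup (h a) r ≡ lookup (h b) r →
                          letterParity a ≡ letterParity b → a ≡ b
h-injective-with-parity = from-yes (all? λ a → all? λ b → all? λ r →
  (lookup (h a) r ≟ᶠ lookup (h b) r) →-dec (letterParity a ≟ᵖ letterParity b) →-dec (a ≟ᶠ b))

h-injective-on-consecutive : ∀ a b (j : Fin 3) →
  lookup (h a) (inject₁ j) ≡ lookup (h b) (inject₁ j) →
  lookup (h a) (Fin.suc j) ≡ lookup (h b) (Fin.suc j) → a ≡ b
h-injective-on-consecutive = from-yes (all? λ a → all? λ b → all? λ j →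
  (lookup (h a) (inject₁ j) ≟ᶠ lookup (h b) (inject₁ j)) →-dec
  (lookup (h a) (Fin.suc j) ≟ᶠ lookup (h b) (Fin.suc j)) →-dec (a ≟ᶠ b))

hWord-5-factors-shifted-by-2-differ : ∀ a b a′ b′ c′ (r : Fin 4) →
  Alternating a b → Alternating a′ b′ → Alternating b′ c′ →
  slice (toℕ r) 5 (hWord (a ∷ b ∷ [])) ≢ slice (2 + toℕ r) 5 (hWord (a′ ∷ b′ ∷ c′ ∷ []))
hWord-5-factors-shifted-by-2-differ = from-yes
  (all? λ a → all? λ b → all? λ a′ → all? λ b′ → all? λ c′ → all? λ (r : Fin 4) →
   alternating? a b →-dec alternating? a′ b′ →-dec alternating? b′ c′ →-dec
   ¬? (≡-dec _≟ᶠ_ (slice (toℕ r) 5 (hWord (a ∷ b ∷ [])))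
                  (slice (2 + toℕ r) 5 (hWord (a′ ∷ b′ ∷ c′ ∷ [])))))

hWord-4-factors-not-squares : ∀ a b (r : Fin 4) → Alternating a b →
  let v = slice (toℕ r) 4 (hWord (a ∷ b ∷ [])) in take 2 v ≢ drop 2 v
hWord-4-factors-not-squares = from-yes (all? λ a → all? λ b → all? λ (r : Fin 4) →
  alternating? a b →-dec
  (let v = slice (toℕ r) 4 (hWord (a ∷ b ∷ [])) in ¬? (≡-dec _≟ᶠ_ (take 2 v) (drop 2 v))))

h²Slice-not-reversed : ∀ a b r₁ r₂ a′ b′ r₁′ r₂′ → Alternating a b → Alternating a′ b′ →
  h²Slice a′ b′ r₁′ r₂′ ≢ reverse (h²Slice a b r₁ r₂)
h²Slice-not-reversed = from-yes
  (all? λ a → all? λ b → all? λ r₁ → all? λ r₂ → all? λ a′ → all? λ b′ → all? λ r₁′ → all? λ r₂′ →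
   alternating? a b →-dec alternating? a′ b′ →-dec
   ¬? (≡-dec _≟ᶠ_ (h²Slice a′ b′ r₁′ r₂′) (reverse (h²Slice a b r₁ r₂))))

fixedPointStep : ∀ n → WfRec _<_ (λ _ → Fin 4) n → Fin 4
fixedPointStep zero      _   = 0F
fixedPointStep n@(suc _) rec = lookup (h (rec (m/n<m n 4 (s≤s (s≤s z≤n))))) (n mod 4)

fixedPointStep-cong : ∀ n {rec rec′ : WfRec _<_ (λ _ → Fin 4) n} →
                      (∀ {m} (m<n : m < n) → rec m<n ≡ rec′ m<n) →
                      fixedPointStep n rec ≡ fixedPointStep n rec′
fixedPointStep-cong zero    _    = refl
fixedPointStep-cong (suc n) rec≗ = cong (λ a → lookup (h a) (suc n mod 4)) (rec≗ _)

open FixPoint <-wellFounded (λ _ → Fin 4) fixedPointStep fixedPointStep-cong using (unfold-wfRec)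

-- Opaque, so that conversion checking never unfolds the well-founded
-- recursion (which is prohibitively expensive); w-unfold is its interface.
opaque
  w : InfWord
  w = <-rec _ fixedPointStep

  w-unfold : ∀ n → w n ≡ lookup (h (w (n / 4))) (n mod 4)
  w-unfold zero    = trans w0 (cong (λ a → lookup (h a) 0F) (sym w0))
    where
    w0 : w 0 ≡ 0F
    w0 = unfold-wfRec {0}
  w-unfold (suc n) = unfold-wfRec {suc n}

/4-block : ∀ (r : Fin 4) q → (toℕ r + q * 4) / 4 ≡ q
/4-block r q = begin
  (toℕ r + q * 4) / 4    ≡⟨ +-distrib-/-∣ʳ (toℕ r) (n∣m*n q) ⟩
  toℕ r / 4 + q * 4 / 4  ≡⟨ cong₂ _+_ (m<n⇒m/n≡0 (toℕ<n r)) (m*n/n≡m q 4) ⟩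
  q                      ∎
  where open ≡-Reasoning

mod4-block : ∀ (r : Fin 4) q → (toℕ r + q * 4) mod 4 ≡ r
mod4-block r q = toℕ-injective (begin
  toℕ ((toℕ r + q * 4) mod 4) ≡⟨ toℕ-fromℕ< _ ⟩
  (toℕ r + q * 4) % 4         ≡⟨ [m+kn]%n≡m%n (toℕ r) q 4 ⟩
  toℕ r % 4                   ≡⟨ m<n⇒m%n≡m (toℕ<n r) ⟩
  toℕ r                       ∎)
  where open ≡-Reasoning

w-block : ∀ (r : Fin 4) q → w (toℕ r + q * 4) ≡ lookup (h (w q)) r
w-block r q = trans (w-unfold (toℕ r + q * 4))
                    (cong₂ (λ n r → lookup (h (w n)) r) (/4-block r q) (mod4-block r q))

parity-block : ∀ (r : Fin 4) q → parity (toℕ r + q * 4) ≡ letterParity r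
parity-block r q = begin
  parity (toℕ r + q * 4)                   ≡⟨ ℙ.+-homo-+ (toℕ r) (q * 4) ⟩
  letterParity r ℙ.+ parity (q * 4)        ≡⟨ cong (letterParity r ℙ.+_) (ℙ.*-homo-* q 4) ⟩
  letterParity r ℙ.+ (parity q ℙ.* 0ℙ)     ≡⟨ cong (letterParity r ℙ.+_) (ℙ.*-zeroʳ (parity q)) ⟩
  letterParity r ℙ.+ 0ℙ                    ≡⟨ ℙ.+-identityʳ (letterParity r) ⟩
  letterParity r                           ∎
  where open ≡-Reasoning

parity-+-even : ∀ n {s} → parity s ≡ 0ℙ → parity (n + s) ≡ parity n
parity-+-even n {s} s-even = begin
  parity (n + s)          ≡⟨ ℙ.+-homo-+ n s ⟩
  parity n ℙ.+ parity s   ≡⟨ cong (parity n ℙ.+_) s-even ⟩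
  parity n ℙ.+ 0ℙ         ≡⟨ ℙ.+-identityʳ (parity n) ⟩
  parity n                ∎
  where open ≡-Reasoning

w-parity : ∀ n → letterParity (w n) ≡ parity n
w-parity n with n divMod 4
... | result q r refl = begin
  letterParity (w (toℕ r + q * 4))    ≡⟨ cong letterParity (w-block r q) ⟩
  letterParity (lookup (h (w q)) r)   ≡⟨ h-parity (w q) r ⟩
  letterParity r                      ≡⟨ parity-block r q ⟨
  parity (toℕ r + q * 4)              ∎
  where open ≡-Reasoning

w-alternating : ∀ n → Alternating (w n) (w (suc n))
w-alternating n = begin
  letterParity (w (suc n))   ≡⟨ w-parity (suc n) ⟩
  parity (suc n)             ≡⟨ ℙ.⁻¹-selfInverse (ℙ.suc-homo-⁻¹ n) ⟨
  parity n ⁻¹                ≡⟨ cong _⁻¹ (w-parity n) ⟨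
  letterParity (w n) ⁻¹      ∎
  where open ≡-Reasoning

w-agree⇒even-distance : ∀ {x p} → w x ≡ w (x + p) → parity p ≡ 0ℙ
w-agree⇒even-distance {x} {p} eq = ℙ.+-cancelˡ-≡ (parity x) _ _ (begin
  parity x ℙ.+ parity p        ≡⟨ ℙ.+-homo-+ x p ⟨
  parity (x + p)               ≡⟨ w-parity (x + p) ⟨
  letterParity (w (x + p))     ≡⟨ cong letterParity eq ⟨
  letterParity (w x)           ≡⟨ w-parity x ⟩
  parity x                     ≡⟨ ℙ.+-identityʳ (parity x) ⟨
  parity x ℙ.+ 0ℙ              ∎)
  where open ≡-Reasoning

w-disagree-at-odd-distance : ∀ {x p} → parity p ≡ 1ℙ → w x ≢ w (x + p)
w-disagree-at-odd-distance p-odd eq with trans (sym p-odd) (w-agree⇒even-distance eq)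
... | ()

forbidden-same-parity : ∀ {a b} → Forbidden a b → letterParity a ≡ letterParity b
forbidden-same-parity (inj₁ (a≡0 , b≡2)) =
  trans (cong parity a≡0) (cong parity (sym b≡2))
forbidden-same-parity (inj₂ (inj₁ (a≡2 , b≡0))) =
  trans (cong parity a≡2) (cong parity (sym b≡0))
forbidden-same-parity (inj₂ (inj₂ (inj₁ (a≡1 , b≡3)))) =
  trans (cong parity a≡1) (cong parity (sym b≡3))
forbidden-same-parity (inj₂ (inj₂ (inj₂ (a≡3 , b≡1)))) =
  trans (cong parity a≡3) (cong parity (sym b≡1))

w-reduced : Reduced w
w-reduced i forbidden = ℙ.p≢p⁻¹ _ (trans (forbidden-same-parity forbidden) (w-alternating i))

factor : InfWord → ℕ → ℕ → List (Fin 4)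
factor u i zero    = []
factor u i (suc L) = u i ∷ factor u (suc i) L

take-factor : ∀ u i a b → take a (factor u i (a + b)) ≡ factor u i a
take-factor u i zero    b = refl
take-factor u i (suc a) b = cong (u i ∷_) (take-factor u (suc i) a b)

drop-factor : ∀ u i a b → drop a (factor u i (a + b)) ≡ factor u (a + i) b
drop-factor u i zero    b = refl
drop-factor u i (suc a) b =
  trans (drop-factor u (suc i) a b) (cong (λ j → factor u j b) (+-suc a i))

factor-snoc : ∀ u i d → factor u i (suc d) ≡ factor u i d ++ [ u (d + i) ]
factor-snoc u i zero    = refl
factor-snoc u i (suc d) = cong (u i ∷_) (trans (factor-snoc u (suc i) d)
                                               (cong (λ j → factor u (suc i) d ++ [ u j ]) (+-suc d i)))

reversal-factor : ∀ {u d i j} → ReversalAt u d i j → factor u j d ≡ reverse (factor u i d)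
reversal-factor {u} {zero}  rev = refl
reversal-factor {u} {suc d} {i} {j} rev = begin
  u j ∷ factor u (suc j) d                  ≡⟨ cong₂ _∷_ first (reversal-factor rest) ⟩
  u (d + i) ∷ reverse (factor u i d)        ≡⟨ reverse-++ (factor u i d) [ u (d + i) ] ⟨
  reverse (factor u i d ++ [ u (d + i) ])   ≡⟨ cong reverse (factor-snoc u i d) ⟨
  reverse (factor u i (suc d))              ∎
  where
  open ≡-Reasoning
  first : u j ≡ u (d + i)
  first = trans (cong u (sym (+-identityʳ j))) (trans (rev 0 0<1+n) (cong u (+-comm i d)))
  rest : ReversalAt u d i (suc j)
  rest k k<d = trans (cong u (sym (+-suc j k)))
                     (trans (rev (suc k) (s≤s k<d)) (cong (λ m → u (i + m)) (sym (∸-+-assoc d 1 k))))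

-- The factor of length M + p at position i has period p.
record Repeats (u : InfWord) (i p M : ℕ) : Set where
  constructor repeats
  field agree : ∀ k → k < M → u (k + i) ≡ u (k + i + p)
open Repeats

repeats-weaken : ∀ {u i p L M} → L ≤ M → Repeats u i p M → Repeats u i p L
repeats-weaken L≤M R = repeats λ k k<L → agree R k (≤-trans k<L L≤M)

hasPeriod⇒repeats : ∀ {u i L p} → p ≤ L → HasPeriod u i L p → Repeats u i p (L ∸ p)
hasPeriod⇒repeats {u} {i} {L} {p} p≤L period = repeats agree′
  where
  agree′ : ∀ k → k < L ∸ p → u (k + i) ≡ u (k + i + p)
  agree′ k k<L-p rewrite +-comm k i =
    period k (subst (k + p <_) (m∸n+n≡m p≤L) (+-monoˡ-< p k<L-p))

squareAt⇒repeats : ∀ {u i n} → SquareAt u i n → Repeats u i n n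
squareAt⇒repeats {u} {i} {n} square = repeats agree′
  where
  i+n+k≡i+k+n : ∀ k → i + n + k ≡ i + k + n
  i+n+k≡i+k+n k = trans (+-assoc i n k) (trans (cong (i +_) (+-comm n k)) (sym (+-assoc i k n)))
  agree′ : ∀ k → k < n → u (k + i) ≡ u (k + i + n)
  agree′ k k<n rewrite +-comm k i = trans (square k k<n) (cong u (i+n+k≡i+k+n k))

repeats-factor : ∀ {u i p L} → Repeats u i p L → factor u i L ≡ factor u (i + p) L
repeats-factor {L = zero}  R = refl
repeats-factor {u} {i} {p} {suc L} R = cong₂ _∷_ (agree R 0 0<1+n) (repeats-factor R′)
  where
  R′ : Repeats u (suc i) p L
  R′ = repeats λ k k<L →
    subst (λ x → u x ≡ u (x + p)) (sym (+-suc k i)) (agree R (suc k) (s≤s k<L))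

factor-w-image : ∀ q → factor w (q * 4) 4 ≡ toList (h (w q))
factor-w-image q = cong toList (begin
  tabulate (λ r → w (toℕ r + q * 4))   ≡⟨ tabulate-cong (λ r → w-block r q) ⟩
  tabulate (lookup (h (w q)))          ≡⟨ tabulate∘lookup (h (w q)) ⟩
  h (w q)                              ∎)
  where open ≡-Reasoning

factor-w-hWord : ∀ q c → factor w (q * 4) (c * 4) ≡ hWord (factor w q c)
factor-w-hWord q zero    = refl
factor-w-hWord q (suc c) = cong₂ _++_ (factor-w-image q) (factor-w-hWord (suc q) c)

factor-w-slice : ∀ k q c L → k + L ≤ c * 4 →
                 factor w (k + q * 4) L ≡ slice k L (hWord (factor w q c))
factor-w-slice k q c L k+L≤4c = begin
  factor w (k + q * 4) L                           ≡⟨ take-factor w (k + q * 4) L d ⟨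
  take L (factor w (k + q * 4) (L + d))            ≡⟨ cong (take L) (drop-factor w (q * 4) k (L + d)) ⟨
  slice k L (factor w (q * 4) (k + (L + d)))       ≡⟨ cong (λ n → slice k L (factor w (q * 4) n)) k+[L+d]≡4c ⟩
  slice k L (factor w (q * 4) (c * 4))             ≡⟨ cong (slice k L) (factor-w-hWord q c) ⟩
  slice k L (hWord (factor w q c))                 ∎
  where
  open ≡-Reasoning
  d : ℕ
  d = c * 4 ∸ (k + L)
  k+[L+d]≡4c : k + (L + d) ≡ c * 4
  k+[L+d]≡4c = trans (sym (+-assoc k L d)) (m+[n∸m]≡n k+L≤4c)

offset+length≤ : ∀ (r : Fin 4) L {n} → 3 + L ≤ n → toℕ r + L ≤ n
offset+length≤ r L = ≤-trans (+-monoˡ-≤ L (toℕ≤pred[n] r))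

factor-w-h²Slice : ∀ (r₁ r₂ : Fin 4) q →
                   factor w (toℕ r₂ + (toℕ r₁ + q * 4) * 4) 12 ≡ h²Slice (w q) (w (suc q)) r₁ r₂
factor-w-h²Slice r₁ r₂ q = begin
  factor w (toℕ r₂ + (toℕ r₁ + q * 4) * 4) 12
    ≡⟨ factor-w-slice (toℕ r₂) (toℕ r₁ + q * 4) 4 12 (offset+length≤ r₂ 12 (n≤1+n 15)) ⟩
  slice (toℕ r₂) 12 (hWord (factor w (toℕ r₁ + q * 4) 4))
    ≡⟨ cong (λ v → slice (toℕ r₂) 12 (hWord v))
            (factor-w-slice (toℕ r₁) q 2 4 (offset+length≤ r₁ 4 (n≤1+n 7))) ⟩
  h²Slice (w q) (w (suc q)) r₁ r₂
    ∎
  where open ≡-Reasoning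

data IsH²Slice : List (Fin 4) → Set where
  h²slice : ∀ a b r₁ r₂ → Alternating a b → IsH²Slice (h²Slice a b r₁ r₂)

factor-w-12 : ∀ n → IsH²Slice (factor w n 12)
factor-w-12 n with n divMod 4
... | result q r₂ refl with q divMod 4
... | result q′ r₁ refl = subst IsH²Slice (sym (factor-w-h²Slice r₁ r₂ q′))
                                (h²slice (w q′) (w (suc q′)) r₁ r₂ (w-alternating q′))

isH²Slice-not-reversed : ∀ {u v} → IsH²Slice u → IsH²Slice v → v ≢ reverse u
isH²Slice-not-reversed (h²slice a b r₁ r₂ alt) (h²slice a′ b′ r₁′ r₂′ alt′) =
  h²Slice-not-reversed a b r₁ r₂ a′ b′ r₁′ r₂′ alt alt′

w-directed : Directed 12 w
w-directed i (j , rev) =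
  isH²Slice-not-reversed (factor-w-12 i) (factor-w-12 j) (reversal-factor {u = w} rev)

w-block-agree : ∀ (j : Fin 4) n s → w (toℕ j + n * 4) ≡ w (toℕ j + n * 4 + s * 4) →
                lookup (h (w n)) j ≡ lookup (h (w (n + s))) j
w-block-agree j n s eq = begin
  lookup (h (w n)) j           ≡⟨ w-block j n ⟨
  w (toℕ j + n * 4)            ≡⟨ eq ⟩
  w (toℕ j + n * 4 + s * 4)    ≡⟨ cong w (trans (+-assoc (toℕ j) (n * 4) (s * 4))
                                                (cong (toℕ j +_) (sym (*-distribʳ-+ 4 n s)))) ⟩
  w (toℕ j + (n + s) * 4)      ≡⟨ w-block j (n + s) ⟩
  lookup (h (w (n + s))) j     ∎
  where open ≡-Reasoning

consecutive-agreements-even : ∀ (j : Fin 3) n s →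
  w (toℕ (inject₁ j) + n * 4) ≡ w (toℕ (inject₁ j) + n * 4 + s * 4) →
  w (toℕ (Fin.suc j) + n * 4) ≡ w (toℕ (Fin.suc j) + n * 4 + s * 4) → parity s ≡ 0ℙ
consecutive-agreements-even j n s eq₁ eq₂ =
  w-agree⇒even-distance (h-injective-on-consecutive (w n) (w (n + s)) j
    (w-block-agree (inject₁ j) n s eq₁) (w-block-agree (Fin.suc j) n s eq₂))

repeats-quarter-even : ∀ s {i} → Repeats w i (s * 4) 3 → parity s ≡ 0ℙ
repeats-quarter-even s {i} R with i divMod 4
... | result q 0F refl = consecutive-agreements-even 0F q s (agree R 0 0<1+n) (agree R 1 (s≤s 0<1+n))
... | result q 1F refl = consecutive-agreements-even 1F q s (agree R 0 0<1+n) (agree R 1 (s≤s 0<1+n))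
... | result q 2F refl = consecutive-agreements-even 2F q s (agree R 0 0<1+n) (agree R 1 (s≤s 0<1+n))
... | result q 3F refl =
  consecutive-agreements-even 0F (suc q) s (agree R 1 (s≤s 0<1+n)) (agree R 2 ≤-refl)

repeats-desubstitute : ∀ r q {s M} → parity s ≡ 0ℙ → Repeats w (toℕ r + q * 4) (s * 4) M →
                       ∀ m → m * 4 ≤ 3 + M → Repeats w q s m
repeats-desubstitute r q {s} {M} s-even R m 4m≤3+M = repeats agree′
  where
  block-shift : ∀ k r q → k * 4 + (r + q * 4) ≡ r + (k + q) * 4
  block-shift = solve-∀
  agree′ : ∀ k → k < m → w (k + q) ≡ w (k + q + s)
  agree′ k k<m = h-injective-with-parity (w (k + q)) (w (k + q + s)) r letters≡ parities≡
    where
    4k<M : k * 4 < M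
    4k<M = +-cancelˡ-≤ 3 (suc (k * 4)) M (≤-trans (*-monoˡ-≤ 4 k<m) 4m≤3+M)
    letters≡ : lookup (h (w (k + q))) r ≡ lookup (h (w (k + q + s))) r
    letters≡ = w-block-agree r (k + q) s
      (subst (λ x → w x ≡ w (x + s * 4)) (block-shift k (toℕ r) q) (agree R (k * 4) 4k<M))
    parities≡ : letterParity (w (k + q)) ≡ letterParity (w (k + q + s))
    parities≡ = begin
      letterParity (w (k + q))       ≡⟨ w-parity (k + q) ⟩
      parity (k + q)                 ≡⟨ parity-+-even (k + q) s-even ⟨
      parity (k + q + s)             ≡⟨ w-parity (k + q + s) ⟨
      letterParity (w (k + q + s))   ∎
      where open ≡-Reasoning

quarter-ceiling : ∀ M → Σ ℕ λ m → m * 4 ≤ 3 + M × M ≤ m * 4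
quarter-ceiling M with (3 + M) divMod 4
... | result m e 3+M≡ =
  m , subst (m * 4 ≤_) (sym 3+M≡) (m≤n+m (m * 4) (toℕ e))
    , +-cancelˡ-≤ 3 M (m * 4) (≤-trans (≤-reflexive 3+M≡) (+-monoˡ-≤ (m * 4) (toℕ≤pred[n] e)))

repeats-2mod4-short : ∀ s {i M} → Repeats w i (2 + s * 4) M → M ≤ 4
repeats-2mod4-short s {i} {M} R with M ≤? 4 | i divMod 4
... | yes M≤4 | _ = M≤4
... | no M≰4 | result q r refl = ⊥-elim (hWord-5-factors-shifted-by-2-differ
      (w q) (w (suc q)) (w (q + s)) (w (suc (q + s))) (w (suc (suc (q + s)))) r
      (w-alternating q) (w-alternating (q + s)) (w-alternating (suc (q + s))) slices≡)
  where
  shift : ∀ r q s → r + q * 4 + (2 + s * 4) ≡ 2 + r + (q + s) * 4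
  shift = solve-∀
  slices≡ : slice (toℕ r) 5 (hWord (factor w q 2)) ≡ slice (2 + toℕ r) 5 (hWord (factor w (q + s) 3))
  slices≡ = begin
    slice (toℕ r) 5 (hWord (factor w q 2))
      ≡⟨ factor-w-slice (toℕ r) q 2 5 (offset+length≤ r 5 ≤-refl) ⟨
    factor w (toℕ r + q * 4) 5
      ≡⟨ repeats-factor (repeats-weaken (≰⇒> M≰4) R) ⟩
    factor w (toℕ r + q * 4 + (2 + s * 4)) 5
      ≡⟨ cong (λ n → factor w n 5) (shift (toℕ r) q s) ⟩
    factor w (2 + toℕ r + (q + s) * 4) 5
      ≡⟨ factor-w-slice (2 + toℕ r) (q + s) 3 5 (s≤s (s≤s (offset+length≤ r 5 (m≤m+n 8 2)))) ⟩
    slice (2 + toℕ r) 5 (hWord (factor w (q + s) 3))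
      ∎
    where open ≡-Reasoning

repeats-period2-short : ∀ {i M} → Repeats w i 2 M → M ≤ 1
repeats-period2-short {i} {M} R with M ≤? 1 | i divMod 4
... | yes M≤1 | _ = M≤1
... | no M≰1 | result q r refl =
  ⊥-elim (hWord-4-factors-not-squares (w q) (w (suc q)) r (w-alternating q) halves≡)
  where
  x : ℕ
  x = toℕ r + q * 4
  v : List (Fin 4)
  v = slice (toℕ r) 4 (hWord (factor w q 2))
  factor≡v : factor w x 4 ≡ v
  factor≡v = factor-w-slice (toℕ r) q 2 4 (offset+length≤ r 4 (n≤1+n 7))
  halves≡ : take 2 v ≡ drop 2 v
  halves≡ = begin
    take 2 v                ≡⟨ cong (take 2) factor≡v ⟨
    take 2 (factor w x 4)   ≡⟨ take-factor w x 2 2 ⟩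
    factor w x 2            ≡⟨ repeats-factor (repeats-weaken (≰⇒> M≰1) R) ⟩
    factor w (x + 2) 2      ≡⟨ cong (λ n → factor w n 2) (+-comm x 2) ⟩
    factor w (2 + x) 2      ≡⟨ drop-factor w x 2 2 ⟨
    drop 2 (factor w x 4)   ≡⟨ cong (drop 2) factor≡v ⟩
    drop 2 v                ∎
    where open ≡-Reasoning

repeats-2mod4-bound : ∀ s {i M} → Repeats w i (2 + s * 4) M → 3 * M ≤ 2 * (2 + s * 4)
repeats-2mod4-bound zero    R = ≤-trans (*-monoʳ-≤ 3 (repeats-period2-short R)) (n≤1+n 3)
repeats-2mod4-bound (suc s) R =
  ≤-trans (*-monoʳ-≤ 3 (repeats-2mod4-short (suc s) R)) (*-monoʳ-≤ 2 (m≤m+n 6 (s * 4)))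

repeats-quarter-bound : ∀ s {i M} → 0 < s → (∀ {i′ m} → Repeats w i′ s m → 3 * m ≤ 2 * s) →
                        Repeats w i (s * 4) M → 3 * M ≤ 2 * (s * 4)
repeats-quarter-bound s {i} {M} 0<s bound R with M ≤? 2 | i divMod 4 | quarter-ceiling M
... | yes M≤2 | _ | _ =
  ≤-trans (*-monoʳ-≤ 3 M≤2) (≤-trans (m≤m+n 6 2) (*-monoʳ-≤ 2 (*-monoˡ-≤ 4 0<s)))
... | no M≰2 | result q r refl | m , 4m≤3+M , M≤4m = begin
  3 * M        ≤⟨ *-monoʳ-≤ 3 M≤4m ⟩
  3 * (m * 4)  ≡⟨ *-assoc 3 m 4 ⟨
  3 * m * 4    ≤⟨ *-monoˡ-≤ 4 (bound (repeats-desubstitute r q s-even R m 4m≤3+M)) ⟩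
  2 * s * 4    ≡⟨ *-assoc 2 s 4 ⟩
  2 * (s * 4)  ∎
  where
  open ≤-Reasoning
  s-even : parity s ≡ 0ℙ
  s-even = repeats-quarter-even s (repeats-weaken (≰⇒> M≰2) R)

repeats-bound : ∀ p {i M} → 0 < p → Repeats w i p M → 3 * M ≤ 2 * p
repeats-bound = <-rec (λ p → ∀ {i M} → 0 < p → Repeats w i p M → 3 * M ≤ 2 * p) bound
  where
  bound : ∀ p → (∀ {p′} → p′ < p → ∀ {i M} → 0 < p′ → Repeats w i p′ M → 3 * M ≤ 2 * p′) →
          ∀ {i M} → 0 < p → Repeats w i p M → 3 * M ≤ 2 * p
  bound p _ {M = zero} _ _ = z≤n
  bound p IH {i} {suc M} 0<p R with p divMod 4
  ... | result s 1F refl       = ⊥-elim (w-disagree-at-odd-distance (parity-block 1F s) (agree R 0 0<1+n))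
  ... | result s 3F refl       = ⊥-elim (w-disagree-at-odd-distance (parity-block 3F s) (agree R 0 0<1+n))
  ... | result s 2F refl       = repeats-2mod4-bound s R
  ... | result zero 0F refl    = ⊥-elim (n≮0 0<p)
  ... | result (suc s) 0F refl =
    repeats-quarter-bound (suc s) 0<1+n (IH (m<m*n (suc s) 4 (s≤s (s≤s z≤n))) 0<1+n) R

w-period-bound : ∀ {i L p} → 0 < p → HasPeriod w i L p → 3 * L ≤ 5 * p
w-period-bound {i} {L} {p} 0<p period with p ≤? L
... | no p≰L = ≤-trans (*-monoʳ-≤ 3 (<⇒≤ (≰⇒> p≰L))) (*-monoˡ-≤ p (m≤m+n 3 2))
... | yes p≤L = begin
  3 * L                ≡⟨ cong (3 *_) (m∸n+n≡m p≤L) ⟨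
  3 * (L ∸ p + p)      ≡⟨ *-distribˡ-+ 3 (L ∸ p) p ⟩
  3 * (L ∸ p) + 3 * p  ≤⟨ +-monoˡ-≤ (3 * p) (repeats-bound p 0<p (hasPeriod⇒repeats p≤L period)) ⟩
  2 * p + 3 * p        ≡⟨ *-distribʳ-+ p 2 3 ⟨
  5 * p                ∎
  where open ≤-Reasoning

w-five-thirds-free : FiveThirdsPlusFree w
w-five-thirds-free i L p _ (0<p , period , _) = ≤⇒≯ (w-period-bound 0<p period)

w-squarefree : SquareFree w
w-squarefree i n 0<n square =
  <⇒≱ (m<n+m (2 * n) 0<n) (repeats-bound n 0<n (squareAt⇒repeats square))

mainTheorem19 : Σ InfWord (λ w → Dean w × FiveThirdsPlusFree w × Directed 12 w)
mainTheorem19 = w , (w-reduced , w-squarefree) , w-five-thirds-free , w-directed
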